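{- Let $\mathtt{p}$ be a CF program that terminates on every input and has no call overlap. Then $\mathtt{p}$ is a CFpoly program, i.e., there is a polynomial $\pi$ with $\mathit{time}_{\mathtt{p}}(x)\le\pi(|x|)$ for all $x\in\{0,1\}^*$.
   Context: CF is a first-order, call-by-value functional language with no data constructors. A CF program is a finite sequence of function definitions $\mathtt{f\ x1 \ldots xm = e}$; the first definition $\mathtt{f_1\ x=e}$ is the entry function. Expressions are $\mathtt{True}$, $\mathtt{False}$, $\mathtt{[\,]}$, variables, $\mathtt{not\ e}$, $\mathtt{null\ e}$, $\mathtt{head\ e}$, $\mathtt{tail\ e}$, $\mathtt{if\ e\ then\ e\ else\ e}$, and calls $\mathtt{f\ e1\ldots em}$. Values are bits or bit lists. The semantics is given by big-step inference rules $\mathtt{p},\rho\vdash\mathtt{e}\to v$. A call evaluates its arguments and then the body of the called function in the environment binding its parameters. The derivation tree on input $x$ is $\mathcal{T}^{\mathtt{p},x}$, and $\mathit{time}_{\mathtt{p}}(x)=|\mathcal{T}^{\mathtt{p},x}|$. The program $\mathtt{p}$ has call overlap if, on some input, it calls the same defined function more than once with the same tuple of argument values; "no call overlap" means this never happens on any input. A CFpoly program is a CF program whose running time is bounded by a polynomial in the input length. -}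

module Defs where

open import Data.Bool using (Bool; true; false)
import Data.Bool as B
open import Data.Nat using (ℕ; zero; suc; _+_; _*_; _≤_)
open import Data.Fin using (Fin; zero; suc)
open import Data.List using (List; []; _∷_; _++_; length)
import Data.List as L
open import Data.Vec using (Vec; []; _∷_; lookup)
open import Data.Product using (Σ; _,_; ∃)
open import Data.List.Relation.Unary.Unique.Propositional using (Unique)
open import Relation.Binary.PropositionalEquality using (_≡_; subst; sym)

data Val : Set where
  bit : Bool → Val
  lst : List Bool → Val

data Exp (k : ℕ) (ar : Fin k → ℕ) (m : ℕ) : Set where
  True False nil : Exp k ar m
  var   : Fin m → Exp k ar m
  not   : Exp k ar m → Exp k ar m
  null  : Exp k ar m → Exp k ar m
  head  : Exp k ar m → Exp k ar m
  tail  : Exp k ar m → Exp k ar m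
  if_then_else_ : Exp k ar m → Exp k ar m → Exp k ar m → Exp k ar m
  call  : (f : Fin k) → Vec (Exp k ar m) (ar f) → Exp k ar m

-- A CF program: definitions f_1 … f_(k'+1); the first (index zero) is the
-- entry function and has arity 1.
record Program : Set where
  field
    k'       : ℕ
    ar       : Fin (suc k') → ℕ
    entry-ar : ar zero ≡ 1
    body     : (f : Fin (suc k')) → Exp (suc k') ar (ar f)

module Sem (p : Program) where
  open Program p

  E : ℕ → Set
  E m = Exp (suc k') ar m

  mutual
    data _⊢_⇓_ {m : ℕ} (ρ : Vec Val m) : E m → Val → Set where
      ev-true  : ρ ⊢ True ⇓ bit true
      ev-false : ρ ⊢ False ⇓ bit false
      ev-nil   : ρ ⊢ nil ⇓ lst []
      ev-var   : (i : Fin m) → ρ ⊢ var i ⇓ lookup ρ i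
      ev-not   : ∀ {e b} → ρ ⊢ e ⇓ bit b → ρ ⊢ not e ⇓ bit (B.not b)
      ev-null  : ∀ {e xs} → ρ ⊢ e ⇓ lst xs → ρ ⊢ null e ⇓ bit (L.null xs)
      ev-head  : ∀ {e b bs} → ρ ⊢ e ⇓ lst (b ∷ bs) → ρ ⊢ head e ⇓ bit b
      ev-tail  : ∀ {e b bs} → ρ ⊢ e ⇓ lst (b ∷ bs) → ρ ⊢ tail e ⇓ lst bs
      ev-if-t  : ∀ {e e₁ e₂ v} → ρ ⊢ e ⇓ bit true → ρ ⊢ e₁ ⇓ v →
                 ρ ⊢ if e then e₁ else e₂ ⇓ v
      ev-if-f  : ∀ {e e₁ e₂ v} → ρ ⊢ e ⇓ bit false → ρ ⊢ e₂ ⇓ v →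
                 ρ ⊢ if e then e₁ else e₂ ⇓ v
      ev-call  : ∀ {f es vs v} → ρ ⊢* es ⇓ vs → vs ⊢ body f ⇓ v →
                 ρ ⊢ call f es ⇓ v

    data _⊢*_⇓_ {m : ℕ} (ρ : Vec Val m) : ∀ {n} → Vec (E m) n → Vec Val n → Set where
      ev-[] : ρ ⊢* [] ⇓ []
      ev-∷  : ∀ {n e v} {es : Vec (E m) n} {vs} →
              ρ ⊢ e ⇓ v → ρ ⊢* es ⇓ vs → ρ ⊢* (e ∷ es) ⇓ (v ∷ vs)

  mutual
    size : ∀ {m} {ρ : Vec Val m} {e v} → ρ ⊢ e ⇓ v → ℕ
    size ev-true = 1
    size ev-false = 1
    size ev-nil = 1
    size (ev-var i) = 1
    size (ev-not d) = suc (size d)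
    size (ev-null d) = suc (size d)
    size (ev-head d) = suc (size d)
    size (ev-tail d) = suc (size d)
    size (ev-if-t d d₁) = suc (size d + size d₁)
    size (ev-if-f d d₂) = suc (size d + size d₂)
    size (ev-call ds d) = suc (size* ds + size d)

    size* : ∀ {m} {ρ : Vec Val m} {n} {es : Vec (E m) n} {vs} → ρ ⊢* es ⇓ vs → ℕ
    size* ev-[] = 0
    size* (ev-∷ d ds) = size d + size* ds

  Call : Set
  Call = Σ (Fin (suc k')) (λ f → Vec Val (ar f))

  mutual
    calls : ∀ {m} {ρ : Vec Val m} {e v} → ρ ⊢ e ⇓ v → List Call
    calls ev-true = []
    calls ev-false = []
    calls ev-nil = []
    calls (ev-var i) = []
    calls (ev-not d) = calls d
    calls (ev-null d) = calls d
    calls (ev-head d) = calls d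
    calls (ev-tail d) = calls d
    calls (ev-if-t d d₁) = calls d ++ calls d₁
    calls (ev-if-f d d₂) = calls d ++ calls d₂
    calls (ev-call {f = f} {vs = vs} ds d) = (f , vs) ∷ (calls* ds ++ calls d)

    calls* : ∀ {m} {ρ : Vec Val m} {n} {es : Vec (E m) n} {vs} → ρ ⊢* es ⇓ vs → List Call
    calls* ev-[] = []
    calls* (ev-∷ d ds) = calls d ++ calls* ds

  inputEnv : List Bool → Vec Val (ar zero)
  inputEnv x = subst (Vec Val) (sym entry-ar) (lst x ∷ [])

  Run : List Bool → Val → Set
  Run x v = inputEnv x ⊢ body zero ⇓ v

  time : ∀ {x v} → Run x v → ℕ
  time d = size d

  Terminates : Set
  Terminates = ∀ (x : List Bool) → ∃ λ v → Run x v

  -- no call overlap: on no input is the same function called twice with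
  -- the same argument tuple (the initial call f₁ x included)
  NoCallOverlap : Set
  NoCallOverlap = ∀ (x : List Bool) v (d : Run x v) →
    Unique ((zero , inputEnv x) ∷ calls d)

-- Polynomials with natural-number coefficients (constant term first).
Poly : Set
Poly = List ℕ

evalPoly : Poly → ℕ → ℕ
evalPoly [] n = 0
evalPoly (c ∷ cs) n = c + n * evalPoly cs n

CFpoly : Program → Set
CFpoly p = ∃ λ (π : Poly) → ∀ (x : List Bool) v (d : Run x v) → time d ≤ evalPoly π (length x)
  where open Sem p

module Submission where

-- Fix a program p and an input x with n = |x|.  Every value occurring in a
-- run on x is a bit or a suffix of x: the only list-producing operations are
-- [] and tail.  Hence every call performed in the run has its arguments drawn
-- from a fixed list of n + 3 values, so there are at most k · (n + 3)^A
-- possible calls, where k is the number of functions and A bounds their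
-- arities.  Without call overlap all calls of the run are distinct, so by the
-- pigeonhole principle the run performs at most that many calls.  Finally the
-- derivation tree is made of the calls' body evaluations, each of size at most
-- B (a bound on the size of the function bodies), so its size is at most
-- B + B · k · (n + 3)^A, which is a polynomial in n.

open import Defs
open import Data.Bool using (Bool; true; false)
open import Data.Unit using (⊤; tt)
open import Data.Nat using (ℕ; zero; suc; _+_; _*_; _^_; _⊔_; _≤_; z≤n; s≤s; NonZero; >-nonZero)
open import Data.Nat.Properties
open import Data.Fin using (Fin; zero; suc)
open import Data.List using (List; []; _∷_; _++_; length; map; tails; allFin; concatMap; cartesianProductWith)
open import Data.List.Properties using (length-++; length-map; length-tabulate; length-removeAt′)
open import Data.List.Membership.Propositional using (_∈_)
open import Data.List.Membership.Propositional.Properties using (∈-map⁺; ∈-allFin; ∈-concat⁺′; ∈-cartesianProductWith⁺)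
open import Data.List.Relation.Unary.Any using (here; there; _─_)
open import Data.List.Relation.Unary.All as All using (All; []; _∷_)
open import Data.List.Relation.Unary.All.Properties using (++⁺)
open import Data.List.Relation.Unary.Unique.Propositional using (Unique)
open import Data.List.Relation.Unary.AllPairs using ([]; _∷_)
import Data.List.Relation.Unary.AllPairs as AllPairs
open import Data.List.Relation.Binary.Suffix.Heterogeneous using (Suffix; here; there)
import Data.List.Relation.Binary.Suffix.Heterogeneous as Suffix
open import Data.List.Relation.Binary.Pointwise using ([]; Pointwise-≡⇒≡; ≡⇒Pointwise-≡)
import Data.Vec as V
open import Data.Vec using (Vec)
import Data.Vec.Relation.Unary.All as VA
open import Data.Vec.Relation.Unary.All.Properties using (lookup⁺)
open import Data.Product using (Σ; _,_; ∃; _×_; proj₁; proj₂)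
open import Function using (_∘_)
open import Relation.Nullary using (contradiction)
open import Relation.Binary.PropositionalEquality
open import Data.Nat.Tactic.RingSolver using (solve-∀)

-- Removing the head's occurrence from ys
-- keeps the remaining (distinct) elements inside.
module _ {A : Set} where

  ∈-─ : ∀ {x z : A} {ys} (x∈ys : x ∈ ys) → z ∈ ys → x ≢ z → z ∈ (ys ─ x∈ys)
  ∈-─ (here refl) (here refl)  x≢z = contradiction refl x≢z
  ∈-─ (here refl) (there z∈ys) x≢z = z∈ys
  ∈-─ (there x∈ys) (here refl) x≢z = here refl
  ∈-─ (there x∈ys) (there z∈ys) x≢z = there (∈-─ x∈ys z∈ys x≢z)

  unique⇒length-≤ : ∀ {xs ys : List A} → Unique xs → All (_∈ ys) xs → length xs ≤ length ys
  unique⇒length-≤ [] [] = z≤n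
  unique⇒length-≤ {x ∷ xs} {ys} (x≢xs ∷ u) (x∈ys ∷ xs⊆ys) = begin
      suc (length xs)                ≤⟨ s≤s (unique⇒length-≤ u xs⊆ys─x) ⟩
      suc (length (ys ─ x∈ys))       ≡⟨ length-removeAt′ ys _ ⟨
      length ys                      ∎
    where
    open ≤-Reasoning
    xs⊆ys─x : All (_∈ (ys ─ x∈ys)) xs
    xs⊆ys─x = All.zipWith (λ (x≢z , z∈ys) → ∈-─ x∈ys z∈ys x≢z) (x≢xs , xs⊆ys)

finite-bounded : ∀ {n} (g : Fin n → ℕ) → ∃ λ B → ∀ i → g i ≤ B
finite-bounded {zero} g = 0 , λ ()
finite-bounded {suc n} g =
  let B , g∘suc≤B = finite-bounded (g ∘ suc) in
  g zero ⊔ B , λ { zero → m≤m⊔n (g zero) B ; (suc i) → ≤-trans (g∘suc≤B i) (m≤n⊔m (g zero) B) }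

module _ {A : Set} where

  length-cartesianProductWith : ∀ {B C : Set} (f : A → B → C) xs ys →
    length (cartesianProductWith f xs ys) ≡ length xs * length ys
  length-cartesianProductWith f []       ys = refl
  length-cartesianProductWith f (x ∷ xs) ys = begin
      length (map (f x) ys ++ cartesianProductWith f xs ys)      ≡⟨ length-++ (map (f x) ys) ⟩
      length (map (f x) ys) + length (cartesianProductWith f xs ys)
        ≡⟨ cong₂ _+_ (length-map (f x) ys) (length-cartesianProductWith f xs ys) ⟩
      length ys + length xs * length ys                          ∎
    where open ≡-Reasoning

  tuples : List A → (n : ℕ) → List (Vec A n)
  tuples S zero    = V.[] ∷ []
  tuples S (suc n) = cartesianProductWith V._∷_ S (tuples S n)

  ∈-tuples : ∀ {S n} {w : Vec A n} → VA.All (_∈ S) w → w ∈ tuples S n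
  ∈-tuples VA.[]           = here refl
  ∈-tuples (a∈S VA.∷ w⊆S) = ∈-cartesianProductWith⁺ V._∷_ a∈S (∈-tuples w⊆S)

  length-tuples : ∀ S n → length (tuples S n) ≡ length S ^ n
  length-tuples S zero    = refl
  length-tuples S (suc n) =
    trans (length-cartesianProductWith V._∷_ S (tuples S n)) (cong (length S *_) (length-tuples S n))

length-concatMap-≤ : ∀ {A B : Set} {c} (g : A → List B) → (∀ a → length (g a) ≤ c) →
  ∀ xs → length (concatMap g xs) ≤ length xs * c
length-concatMap-≤ g g≤c []       = z≤n
length-concatMap-≤ g g≤c (a ∷ xs) =
  ≤-trans (≤-reflexive (length-++ (g a))) (+-mono-≤ (g≤c a) (length-concatMap-≤ g g≤c xs))

module CallsOver {V : Set} {k : ℕ} (ar : Fin k → ℕ) where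

  Call : Set
  Call = Σ (Fin k) (λ f → Vec V (ar f))

  mkCall : (f : Fin k) → Vec V (ar f) → Call
  mkCall f w = f , w

  callsOf : List V → (f : Fin k) → List Call
  callsOf S f = map (mkCall f) (tuples S (ar f))

  callsOver : List V → List Call
  callsOver S = concatMap (callsOf S) (allFin k)

  ∈-callsOver : ∀ {S f} {w : Vec V (ar f)} → VA.All (_∈ S) w → (f , w) ∈ callsOver S
  ∈-callsOver {S} {f} w⊆S = ∈-concat⁺′ (∈-map⁺ (mkCall f) (∈-tuples w⊆S)) (∈-map⁺ (callsOf S) (∈-allFin f))

  length-callsOver : ∀ {A} S → (∀ f → ar f ≤ A) → 1 ≤ length S →
    length (callsOver S) ≤ k * length S ^ A
  length-callsOver {A} S ar≤A 1≤|S| = begin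
      length (callsOver S)      ≤⟨ length-concatMap-≤ (callsOf S) length-callsOf (allFin k) ⟩
      length (allFin k) * L ^ A ≡⟨ cong (_* L ^ A) (length-tabulate {n = k} (λ f → f)) ⟩
      k * L ^ A                ∎
    where
    open ≤-Reasoning
    L = length S
    instance
      L≢0 : NonZero L
      L≢0 = >-nonZero 1≤|S|
    length-callsOf : ∀ f → length (callsOf S f) ≤ L ^ A
    length-callsOf f = begin
      length (callsOf S f)                  ≡⟨ length-map (mkCall f) (tuples S (ar f)) ⟩
      length (tuples S (ar f))              ≡⟨ length-tuples S (ar f) ⟩
      L ^ ar f                              ≤⟨ ^-monoʳ-≤ L (ar≤A f) ⟩
      L ^ A                                 ∎

module PolyArith where

  constᴾ : ℕ → Poly
  constᴾ c = c ∷ []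

  Xᴾ : Poly
  Xᴾ = 0 ∷ 1 ∷ []

  infixl 6 _⊕_
  infixl 7 _⊛_ _·_

  _⊕_ : Poly → Poly → Poly
  []      ⊕ q       = q
  (a ∷ p) ⊕ []      = a ∷ p
  (a ∷ p) ⊕ (b ∷ q) = a + b ∷ p ⊕ q

  _·_ : ℕ → Poly → Poly
  c · p = map (c *_) p

  _⊛_ : Poly → Poly → Poly
  []      ⊛ q = []
  (a ∷ p) ⊛ q = a · q ⊕ (0 ∷ p ⊛ q)

  _^ᴾ_ : Poly → ℕ → Poly
  p ^ᴾ zero  = constᴾ 1
  p ^ᴾ suc e = p ⊛ p ^ᴾ e

  eval-const : ∀ c n → evalPoly (constᴾ c) n ≡ c
  eval-const c n = trans (cong (c +_) (*-zeroʳ n)) (+-identityʳ c)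

  eval-X : ∀ n → evalPoly Xᴾ n ≡ n
  eval-X n = trans (cong (n *_) (eval-const 1 n)) (*-identityʳ n)

  eval-⊕ : ∀ p q n → evalPoly (p ⊕ q) n ≡ evalPoly p n + evalPoly q n
  eval-⊕ []      q       n = refl
  eval-⊕ (a ∷ p) []      n = sym (+-identityʳ _)
  eval-⊕ (a ∷ p) (b ∷ q) n =
    trans (cong (λ r → a + b + n * r) (eval-⊕ p q n)) (rearrange a b n (evalPoly p n) (evalPoly q n))
    where
    rearrange : ∀ a b n P Q → a + b + n * (P + Q) ≡ (a + n * P) + (b + n * Q)
    rearrange = solve-∀

  eval-· : ∀ c p n → evalPoly (c · p) n ≡ c * evalPoly p n
  eval-· c []      n = sym (*-zeroʳ c)
  eval-· c (a ∷ p) n =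
    trans (cong (λ r → c * a + n * r) (eval-· c p n)) (rearrange c a n (evalPoly p n))
    where
    rearrange : ∀ c a n P → c * a + n * (c * P) ≡ c * (a + n * P)
    rearrange = solve-∀

  eval-⊛ : ∀ p q n → evalPoly (p ⊛ q) n ≡ evalPoly p n * evalPoly q n
  eval-⊛ []      q n = refl
  eval-⊛ (a ∷ p) q n = begin
      evalPoly (a · q ⊕ (0 ∷ p ⊛ q)) n          ≡⟨ eval-⊕ (a · q) (0 ∷ p ⊛ q) n ⟩
      evalPoly (a · q) n + n * evalPoly (p ⊛ q) n ≡⟨ cong₂ (λ r s → r + n * s) (eval-· a q n) (eval-⊛ p q n) ⟩
      a * Q + n * (evalPoly p n * Q)              ≡⟨ rearrange a n (evalPoly p n) Q ⟩
      (a + n * evalPoly p n) * Q                  ∎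
    where
    open ≡-Reasoning
    Q : ℕ
    Q = evalPoly q n
    rearrange : ∀ a n P Q → a * Q + n * (P * Q) ≡ (a + n * P) * Q
    rearrange = solve-∀

  eval-^ : ∀ p e n → evalPoly (p ^ᴾ e) n ≡ evalPoly p n ^ e
  eval-^ p zero    n = eval-const 1 n
  eval-^ p (suc e) n = trans (eval-⊛ p (p ^ᴾ e) n) (cong (evalPoly p n *_) (eval-^ p e n))

shifted-power-poly : ∀ b c e → ∃ λ π → ∀ n → evalPoly π n ≡ b + c * (3 + n) ^ e
shifted-power-poly b c e = π , eval-π
  where
  open PolyArith
  X+3 : Poly
  X+3 = constᴾ 3 ⊕ Xᴾ
  π : Poly
  π = constᴾ b ⊕ c · X+3 ^ᴾ e
  eval-X+3 : ∀ n → evalPoly X+3 n ≡ 3 + n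
  eval-X+3 n = trans (eval-⊕ (constᴾ 3) Xᴾ n) (cong₂ _+_ (eval-const 3 n) (eval-X n))
  eval-π : ∀ n → evalPoly π n ≡ b + c * (3 + n) ^ e
  eval-π n = begin
      evalPoly π n                                   ≡⟨ eval-⊕ (constᴾ b) (c · X+3 ^ᴾ e) n ⟩
      evalPoly (constᴾ b) n + evalPoly (c · X+3 ^ᴾ e) n ≡⟨ cong₂ _+_ (eval-const b n) (eval-· c (X+3 ^ᴾ e) n) ⟩
      b + c * evalPoly (X+3 ^ᴾ e) n                  ≡⟨ cong (λ r → b + c * r) (eval-^ X+3 e n) ⟩
      b + c * evalPoly X+3 n ^ e                     ≡⟨ cong (λ r → b + c * r ^ e) (eval-X+3 n) ⟩
      b + c * (3 + n) ^ e                            ∎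
    where open ≡-Reasoning

module _ {A : Set} where

  []-suffix : ∀ (t : List A) → Suffix _≡_ [] t
  []-suffix []      = here []
  []-suffix (_ ∷ t) = there ([]-suffix t)

  suffix⇒∈tails : ∀ {s t : List A} → Suffix _≡_ s t → s ∈ tails t
  suffix⇒∈tails (here s≋t)  = here (Pointwise-≡⇒≡ s≋t)
  suffix⇒∈tails (there suf) = there (suffix⇒∈tails suf)

  length-tails : ∀ (t : List A) → length (tails t) ≡ suc (length t)
  length-tails []      = refl
  length-tails (_ ∷ t) = cong suc (length-tails t)

module Values (x : List Bool) where

  Reachable : Val → Set
  Reachable (bit _) = ⊤
  Reachable (lst s) = Suffix _≡_ s x

  values : List Val
  values = bit true ∷ bit false ∷ map lst (tails x)

  length-values : length values ≡ 3 + length x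
  length-values = cong (2 +_) (trans (length-map lst (tails x)) (length-tails x))

  reachable⇒∈values : ∀ {v} → Reachable v → v ∈ values
  reachable⇒∈values {bit true}  _   = here refl
  reachable⇒∈values {bit false} _   = there (here refl)
  reachable⇒∈values {lst s}     suf = there (there (∈-map⁺ lst (suffix⇒∈tails suf)))

module _ {k : ℕ} {ar : Fin k → ℕ} where
  mutual
    expSize : ∀ {m} → Exp k ar m → ℕ
    expSize True                   = 1
    expSize False                  = 1
    expSize nil                    = 1
    expSize (var _)                = 1
    expSize (not e)                = suc (expSize e)
    expSize (null e)               = suc (expSize e)
    expSize (head e)               = suc (expSize e)
    expSize (tail e)               = suc (expSize e)
    expSize (if e then e₁ else e₂) = suc (expSize e + expSize e₁ + expSize e₂)
    expSize (call f es)            = suc (expSizes es)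

    expSizes : ∀ {m n} → Vec (Exp k ar m) n → ℕ
    expSizes V.[]       = 0
    expSizes (e V.∷ es) = expSize e + expSizes es

module Analysis (p : Program) where
  open Program p
  open Sem p
  open CallsOver {Val} ar using (callsOver; ∈-callsOver; length-callsOver)

  -- A derivation for e consists of the syntax of e plus one body evaluation
  -- per call, so its size is at most |e| + B · #calls when every body has
  -- size at most B.
  module SizeBound {B : ℕ} (body≤B : ∀ f → expSize (body f) ≤ B) where

    add-bounds : ∀ {a b s t} (cs ds : List Call) →
      a ≤ s + B * length cs → b ≤ t + B * length ds → a + b ≤ (s + t) + B * length (cs ++ ds)
    add-bounds {a} {b} {s} {t} cs ds a≤ b≤ = begin
        a + b                                     ≤⟨ +-mono-≤ a≤ b≤ ⟩
        (s + B * length cs) + (t + B * length ds) ≡⟨ rearrange s t B (length cs) (length ds) ⟩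
        (s + t) + B * (length cs + length ds)     ≡⟨ cong (λ l → s + t + B * l) (length-++ cs) ⟨
        (s + t) + B * length (cs ++ ds)           ∎
      where
      open ≤-Reasoning
      rearrange : ∀ s t B l₁ l₂ → (s + B * l₁) + (t + B * l₂) ≡ (s + t) + B * (l₁ + l₂)
      rearrange = solve-∀

    mutual
      size-bound : ∀ {m} {ρ : Vec Val m} {e v} (d : ρ ⊢ e ⇓ v) →
        size d ≤ expSize e + B * length (calls d)
      size-bound ev-true      = m≤m+n 1 _
      size-bound ev-false     = m≤m+n 1 _
      size-bound ev-nil       = m≤m+n 1 _
      size-bound (ev-var i)   = m≤m+n 1 _
      size-bound (ev-not d)   = s≤s (size-bound d)
      size-bound (ev-null d)  = s≤s (size-bound d)
      size-bound (ev-head d)  = s≤s (size-bound d)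
      size-bound (ev-tail d)  = s≤s (size-bound d)
      size-bound (ev-if-t {e = e} {e₁} {e₂} d d₁) =
        s≤s (≤-trans (add-bounds (calls d) (calls d₁) (size-bound d) (size-bound d₁))
                     (+-monoˡ-≤ _ (m≤m+n (expSize e + expSize e₁) (expSize e₂))))
      size-bound (ev-if-f {e = e} {e₁} {e₂} d d₂) =
        s≤s (≤-trans (add-bounds (calls d) (calls d₂) (size-bound d) (size-bound d₂))
                     (+-monoˡ-≤ _ (+-monoˡ-≤ (expSize e₂) (m≤m+n (expSize e) (expSize e₁)))))
      size-bound (ev-call {f = f} {es = es} ds d) =
        s≤s (≤-trans (add-bounds (calls* ds) (calls d) (size-bound* ds) body-bound)
                     (≤-reflexive (absorb (expSizes es) (length (calls* ds ++ calls d)))))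
        where
        body-bound : size d ≤ B + B * length (calls d)
        body-bound = ≤-trans (size-bound d) (+-monoˡ-≤ _ (body≤B f))
        -- the B of the body is the B · 1 contributed by the call (f , vs) itself
        absorb : ∀ s l → (s + B) + B * l ≡ s + B * suc l
        absorb s l = trans (+-assoc s B (B * l)) (cong (s +_) (sym (*-suc B l)))

      size-bound* : ∀ {m} {ρ : Vec Val m} {n} {es : Vec (E m) n} {vs} (ds : ρ ⊢* es ⇓ vs) →
        size* ds ≤ expSizes es + B * length (calls* ds)
      size-bound* ev-[]       = z≤n
      size-bound* (ev-∷ d ds) = add-bounds (calls d) (calls* ds) (size-bound d) (size-bound* ds)

  -- In a run on x from an environment of reachable values, every computed
  -- value is reachable (only [] and tail create lists), hence so are the
  -- arguments of every call performed.
  module Reachability (x : List Bool) where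
    open Values x

    ArgsReachable : Call → Set
    ArgsReachable (_ , vs) = VA.All Reachable vs

    mutual
      reachable : ∀ {m} {ρ : Vec Val m} {e v} → VA.All Reachable ρ → (d : ρ ⊢ e ⇓ v) →
        Reachable v × All ArgsReachable (calls d)
      reachable ρ↓ ev-true        = tt , []
      reachable ρ↓ ev-false       = tt , []
      reachable ρ↓ ev-nil         = []-suffix x , []
      reachable ρ↓ (ev-var i)     = lookup⁺ ρ↓ i , []
      reachable ρ↓ (ev-not d)     = tt , proj₂ (reachable ρ↓ d)
      reachable ρ↓ (ev-null d)    = tt , proj₂ (reachable ρ↓ d)
      reachable ρ↓ (ev-head d)    = tt , proj₂ (reachable ρ↓ d)
      reachable ρ↓ (ev-tail d)    =
        let suf , cs↓ = reachable ρ↓ d in Suffix.tail suf , cs↓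
      reachable ρ↓ (ev-if-t d d₁) =
        let v₁↓ , cs₁↓ = reachable ρ↓ d₁ in v₁↓ , ++⁺ (proj₂ (reachable ρ↓ d)) cs₁↓
      reachable ρ↓ (ev-if-f d d₂) =
        let v₂↓ , cs₂↓ = reachable ρ↓ d₂ in v₂↓ , ++⁺ (proj₂ (reachable ρ↓ d)) cs₂↓
      reachable ρ↓ (ev-call ds d) =
        let vs↓ , cs*↓ = reachable* ρ↓ ds ; v↓ , cs↓ = reachable vs↓ d in
        v↓ , vs↓ ∷ ++⁺ cs*↓ cs↓

      reachable* : ∀ {m} {ρ : Vec Val m} {n} {es : Vec (E m) n} {vs} → VA.All Reachable ρ →
        (ds : ρ ⊢* es ⇓ vs) → VA.All Reachable vs × All ArgsReachable (calls* ds)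
      reachable* ρ↓ ev-[]       = VA.[] , []
      reachable* ρ↓ (ev-∷ d ds) =
        let v↓ , cs↓ = reachable ρ↓ d ; vs↓ , cs*↓ = reachable* ρ↓ ds in
        v↓ VA.∷ vs↓ , ++⁺ cs↓ cs*↓

    inputEnv-reachable : VA.All Reachable (inputEnv x)
    inputEnv-reachable = reachable-subst (sym entry-ar)
      where
      reachable-subst : ∀ {m} (eq : 1 ≡ m) → VA.All Reachable (subst (Vec Val) eq (lst x V.∷ V.[]))
      reachable-subst refl = here (≡⇒Pointwise-≡ refl) VA.∷ VA.[]

    distinct-calls-bound : ∀ {A} → (∀ f → ar f ≤ A) → ∀ {v} (d : Run x v) → Unique (calls d) →
      length (calls d) ≤ suc k' * (3 + length x) ^ A
    distinct-calls-bound {A} ar≤A d distinct = begin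
        length (calls d)                      ≤⟨ unique⇒length-≤ distinct calls⊆callsOver ⟩
        length (callsOver values)             ≤⟨ length-callsOver values ar≤A (s≤s z≤n) ⟩
        suc k' * length values ^ A            ≡⟨ cong (λ l → suc k' * l ^ A) length-values ⟩
        suc k' * (3 + length x) ^ A           ∎
      where
      open ≤-Reasoning
      calls⊆callsOver : All (_∈ callsOver values) (calls d)
      calls⊆callsOver = All.map (λ args↓ → ∈-callsOver (VA.map reachable⇒∈values args↓))
                                (proj₂ (reachable inputEnv-reachable d))

  A : ℕ
  A = proj₁ (finite-bounded ar)

  ar≤A : ∀ f → ar f ≤ A
  ar≤A = proj₂ (finite-bounded ar)

  B : ℕ
  B = proj₁ (finite-bounded (expSize ∘ body))

  body≤B : ∀ f → expSize (body f) ≤ B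
  body≤B = proj₂ (finite-bounded (expSize ∘ body))

  run-time-bound : ∀ {x v} (d : Run x v) → Unique (calls d) →
    time d ≤ B + B * suc k' * (3 + length x) ^ A
  run-time-bound {x} d distinct = begin
      size d                                  ≤⟨ size-bound d ⟩
      expSize (body zero) + B * length (calls d)
        ≤⟨ +-mono-≤ (body≤B zero) (*-monoʳ-≤ B (distinct-calls-bound ar≤A d distinct)) ⟩
      B + B * (suc k' * (3 + length x) ^ A)   ≡⟨ cong (B +_) (*-assoc B (suc k') _) ⟨
      B + B * suc k' * (3 + length x) ^ A     ∎
    where
    open ≤-Reasoning
    open SizeBound body≤B
    open Reachability x

-- Main theorem: a CF program without call overlap runs in polynomial time.
lemma6 : (p : Program) → Sem.Terminates p → Sem.NoCallOverlap p → CFpoly p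
lemma6 p _ no-overlap = π , time≤π
  where
  open Program p
  open Analysis p
  poly : ∃ λ π → ∀ n → evalPoly π n ≡ B + B * suc k' * (3 + n) ^ A
  poly = shifted-power-poly B (B * suc k') A
  π : Poly
  π = proj₁ poly
  time≤π : ∀ x v (d : Sem.Run p x v) → Sem.time p d ≤ evalPoly π (length x)
  time≤π x v d = begin
      Sem.time p d                            ≤⟨ run-time-bound d (AllPairs.tail (no-overlap x v d)) ⟩
      B + B * suc k' * (3 + length x) ^ A     ≡⟨ proj₂ poly (length x) ⟨
      evalPoly π (length x)                   ∎
    where open ≤-Reasoning
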